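{- Assume the setting below and let $n<\omega$. Suppose that every directed family $D$ of conditions in $\mathbb A_n$ with $|D|<\kappa_n$ on which the map $d\mapsto\pi(d)$ is constant admits a lower bound in $\mathbb A_n$. Then $\mathbb A_n$ is $\kappa_n$-directed-closed.
   Context: Setting: $\Sigma=\langle\kappa_n\mid n<\omega\rangle$ is a non-decreasing sequence of regular uncountable cardinals converging to $\kappa$; $\mathbb P=(P,\le)$ and $\mathbb A=(A,\unlhd)$ are notions of forcing with greatest elements $1_{\mathbb P},1_{\mathbb A}$; $\mu$ is a cardinal with $1_{\mathbb P}\Vdash\check\mu=\check\kappa^+$; $(\mathbb P,\ell_{\mathbb P},c_{\mathbb P})$ is $\Sigma$-Prikry; $\ell_{\mathbb A},c_{\mathbb A}$ are functions with domain $A$; $(\pitchfork,\pi)$ is a forking projection from $(\mathbb A,\ell_{\mathbb A},c_{\mathbb A})$ to $(\mathbb P,\ell_{\mathbb P},c_{\mathbb P})$. $A_n:=\{a\in A\mid\ell_{\mathbb A}(a)=n\}$ and $\mathbb A_n:=(A_n\cup\{1_{\mathbb A}\},\unlhd)$; $\kappa_n$-directed-closed means every directed subset of size $<\kappa_n$ has a lower bound in $A_n$. $\Sigma$-Prikry: for $\ell:P\to\omega$, $c$ from $P$ into a set of size $\le\mu$, write $P_n:=\{p\mid\ell(p)=n\}$, $P^p_n:=\{q\le p\mid\ell(q)=\ell(p)+n\}$, $q\le^np$ iff $q\in P^p_n$; $U$ is $0$-open iff ($r\in U\Leftrightarrow P^r_0\subseteq U$). $(\mathbb P,\ell,c)$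 is $\Sigma$-Prikry iff (S1) $\ell$ surjective, $q\le p\Rightarrow\ell(q)\ge\ell(p)$, each $p$ has $q\le p$ with $\ell(q)=\ell(p)+1$; (S2) each $\mathbb P_n:=(P_n\cup\{1\},\le)$ is $\kappa_n$-directed-closed; (S3) $c(p)=c(q)\Rightarrow P^p_0\cap P^q_0\ne\emptyset$; (S4) for $q\le^{n+m}p$, $\{r\le^np\mid q\le^mr\}$ has a greatest element $m(p,q)$, $w(p,q):=0(p,q)$; (S5) $|W(p)|<\mu$ with $W(p):=\{w(p,q)\mid q\le p\}$; (S6) for $p'\le p$, $q\mapsto w(p,q)$ is order-preserving $W(p')\to W(p)$; (S7) for $0$-open $U$, $p$, $n$ there is $q\le^0p$ with $P^q_n\cap U=\emptyset$ or $P^q_n\subseteq U$. For $\mathbb A$ define $A^a_n$, $\unlhd^n$, $m(a,b)$ (greatest element of $\{d\in A^a_n\mid b\in A^d_m\}$), $w(a,b)$, cones $\mathbb A{\downarrow}a$ analogously. Forking projection: (F1) $\pi:A\to P$ is a projection (greatest to greatest, order-preserving, for $a$ and $p'\le\pi(a)$ there is $a'\unlhd a$ with $\pi(a')\le p'$) and $\ell_{\mathbb A}=\ell_{\mathbb P}\circ\pi$; (F2) each $\pitchfork_a$ is order-preserving from $\mathbb P{\downarrow}\pi(a)$ to $\mathbb A{\downarrow}a$; (F3) each $\{a\mid\pi(a)=p\}$ has a greatest element $\lceil p\rceil^{\mathbb A}$; (F4) for $b\unlhd^{n+m}a$, $m(a,b)$ exists and equals $\pitchfork_a(m(\pi(a),\pi(b)))$;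 (F5) $\pi(\pitchfork_a(r))=r$; (F6) $a=\lceil\pi(a)\rceil^{\mathbb A}$ iff $\pitchfork_a(r)=\lceil r\rceil^{\mathbb A}$ (for $r\le\pi(a)$); (F7) for $a'\unlhd^0a$, $r\le^0\pi(a')$: $\pitchfork_{a'}(r)\unlhd\pitchfork_a(r)$; (F8) if $c_{\mathbb A}(a)=c_{\mathbb A}(a')$ then $c_{\mathbb P}(\pi(a))=c_{\mathbb P}(\pi(a'))$ and $\pitchfork_a(r)=\pitchfork_{a'}(r)$ for all $r\in P^{\pi(a)}_0\cap P^{\pi(a')}_0$. -}

module Defs where

open import Level using (0ℓ) renaming (suc to lsuc)
open import Data.Nat using (ℕ; zero; suc; _+_) renaming (_≤_ to _≤ℕ_)
open import Data.Product using (Σ; ∃; _×_; _,_)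
open import Data.Sum using (_⊎_)
open import Relation.Nullary using (¬_)
open import Relation.Binary.PropositionalEquality using (_≡_)
open import Function using (_⇔_)
open import Function.Definitions using (Injective)

-- Cardinalities of types (cardinals are represented by types)

_≼_ : Set → Set → Set
I ≼ K = Σ (I → K) (Injective _≡_ _≡_)

_≺_ : Set → Set → Set
I ≺ K = (I ≼ K) × ¬ (K ≼ I)

RegularUncountable : Set → Set₁
RegularUncountable K =
  (ℕ ≼ K) × ¬ (K ≼ ℕ) ×
  (∀ (I : Set) (F : I → Set) → I ≺ K → (∀ i → F i ≺ K) → Σ I F ≺ K)

-- Σ = ⟨κ n | n < ω⟩ non-decreasing sequence of regular uncountable cardinals
-- converging to κ (κ = sup of the κ n)
record CardSeq : Set₁ where
  field
    κs       : ℕ → Set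
    κ        : Set
    regular  : ∀ n → RegularUncountable (κs n)
    nondecr  : ∀ n → κs n ≼ κs (suc n)
    below    : ∀ n → κs n ≼ κ
    cofinal  : ∀ (L : Set) → L ≺ κ → ∃ λ n → L ≼ κs n

record Forcing : Set₁ where
  field
    Carrier : Set
    _≤_     : Carrier → Carrier → Set
    refl≤   : ∀ {p} → p ≤ p
    trans≤  : ∀ {p q r} → p ≤ q → q ≤ r → p ≤ r
    antisym : ∀ {p q} → p ≤ q → q ≤ p → p ≡ q
    one     : Carrier
    one-max : ∀ p → p ≤ one

module Gen (F : Forcing) (ℓ : Forcing.Carrier F → ℕ) where
  open Forcing F

  _≤[_]_ : Carrier → ℕ → Carrier → Set
  q ≤[ n ] p = (q ≤ p) × (ℓ q ≡ ℓ p + n)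

  -- membership in the underlying set of ℙ_n = (P_n ∪ {1}, ≤)
  InLevel : ℕ → Carrier → Set
  InLevel n x = (x ≡ one) ⊎ (ℓ x ≡ n)

  Directed : (Carrier → Set) → Set
  Directed D = ∀ x y → D x → D y → ∃ λ z → D z × z ≤ x × z ≤ y

  DirClosed : ℕ → Set → Set₁
  DirClosed n K = ∀ (D : Carrier → Set) → (∀ x → D x → InLevel n x) →
    Directed D → Σ Carrier D ≺ K →
    ∃ λ b → (ℓ b ≡ n) × (∀ x → D x → b ≤ x)

  IsMid : Carrier → Carrier → ℕ → Carrier → Set
  IsMid p q n s = (s ≤[ n ] p) × (q ≤ s) ×
    (∀ t → t ≤[ n ] p → q ≤ t → t ≤ s)

  InW : Carrier → Carrier → Set
  InW p r = ∃ λ q → (q ≤ p) × IsMid p q 0 r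

  ZeroOpen : (Carrier → Set) → Set
  ZeroOpen U = ∀ r → U r ⇔ (∀ s → s ≤[ 0 ] r → U s)

record SigmaPrikry (Sg : CardSeq) (μ : Set) (P : Forcing)
                   (ℓ : Forcing.Carrier P → ℕ) (C : Set)
                   (c : Forcing.Carrier P → C) : Set₁ where
  open CardSeq Sg
  open Forcing P
  open Gen P ℓ
  field
    c-small : C ≼ μ
    ℓ-surj  : ∀ n → ∃ λ p → ℓ p ≡ n
    ℓ-mono  : ∀ p q → q ≤ p → ℓ p ≤ℕ ℓ q
    ℓ-ext   : ∀ p → ∃ λ q → q ≤[ 1 ] p
    closed  : ∀ n → DirClosed n (κs n)
    compat  : ∀ p q → c p ≡ c q → ∃ λ r → r ≤[ 0 ] p × r ≤[ 0 ] q
    mid     : ∀ n m p q → q ≤[ n + m ] p → ∃ λ s → IsMid p q n s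
    W-small : ∀ p → Σ Carrier (InW p) ≺ μ
    W-mono  : ∀ p p' → p' ≤ p → ∀ q q' → InW p' q → InW p' q' → q ≤ q' →
              ∀ s s' → IsMid p q 0 s → IsMid p q' 0 s' → s ≤ s'
    prikry  : ∀ (U : Carrier → Set) → ZeroOpen U → ∀ p n →
              ∃ λ q → q ≤[ 0 ] p ×
                ((∀ s → s ≤[ n ] q → ¬ U s) ⊎ (∀ s → s ≤[ n ] q → U s))

-- Forking projection (⋔, π) from (𝔸, ℓA, cA) to (ℙ, ℓP, cP).
-- ⋔ a is given as a total function; only its values on the cone
-- ℙ↓π(a) matter.

record ForkingProjection (P A : Forcing)
    (ℓP : Forcing.Carrier P → ℕ) {CP : Set} (cP : Forcing.Carrier P → CP)
    (ℓA : Forcing.Carrier A → ℕ) {CA : Set} (cA : Forcing.Carrier A → CA)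
    (fork : Forcing.Carrier A → Forcing.Carrier P → Forcing.Carrier A)
    (π : Forcing.Carrier A → Forcing.Carrier P) : Set₁ where
  open Forcing P renaming (Carrier to PC; one to 1P)
  open Forcing A using () renaming (Carrier to AC; _≤_ to _⊴_; one to 1A)
  open Gen P ℓP using (_≤[_]_; IsMid)
  open Gen A ℓA using () renaming (_≤[_]_ to _⊴[_]_; IsMid to IsMidA)
  field
    π-one   : π 1A ≡ 1P
    π-mono  : ∀ a b → a ⊴ b → π a ≤ π b
    π-proj  : ∀ a p' → p' ≤ π a → ∃ λ a' → a' ⊴ a × π a' ≤ p'
    ℓ-comm  : ∀ a → ℓA a ≡ ℓP (π a)
    fork-cone : ∀ a r → r ≤ π a → fork a r ⊴ a
    fork-mono : ∀ a r r' → r ≤ π a → r' ≤ π a → r ≤ r' → fork a r ⊴ fork a r'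
    ceil      : PC → AC
    ceil-π    : ∀ p → π (ceil p) ≡ p
    ceil-max  : ∀ p a → π a ≡ p → a ⊴ ceil p
    mid-fork  : ∀ n m a b → b ⊴[ n + m ] a →
                (∃ λ s → IsMidA a b n s) ×
                (∀ s r → IsMidA a b n s → IsMid (π a) (π b) n r → s ≡ fork a r)
    π-fork    : ∀ a r → r ≤ π a → π (fork a r) ≡ r
    ceil-fork : ∀ a → (a ≡ ceil (π a)) ⇔ (∀ r → r ≤ π a → fork a r ≡ ceil r)
    fork-0    : ∀ a a' r → a' ⊴[ 0 ] a → r ≤[ 0 ] π a' →
                fork a' r ⊴ fork a r
    fork-c    : ∀ a a' → cA a ≡ cA a' →
                (cP (π a) ≡ cP (π a')) ×
                (∀ r → r ≤[ 0 ] π a → r ≤[ 0 ] π a' → fork a r ≡ fork a' r)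

module Submission where

-- Let D ⊆ 𝔸_n be directed with |D| < κ_n.
--   1. Its projection π[D] is a directed subset of ℙ_n of size ≤ |D|, so the
--      κ_n-directed-closure of ℙ_n (S2) gives p ∈ P_n below every π(d).
--   2. Forking every d ∈ D ∩ A_n at p yields the family D_p = {⋔_d(p)}.  It lies
--      in A_n, is no larger than D, is directed by (F7), and π is constantly p
--      on it by (F5); so the hypothesis gives a lower bound b ∈ A_n of D_p.
--   3. Since ⋔_d(p) ⊴ d (F2), b is a lower bound of D (the top element is
--      below everything anyway).

open import Defs
open import Data.Nat using (ℕ)
open import Data.Nat.Properties using (≡-irrelevant; +-identityʳ)
open import Data.Product using (Σ; ∃; _×_; _,_)
open import Data.Sum using (inj₁; inj₂)
open import Relation.Binary.PropositionalEquality using (_≡_; refl; sym; trans; cong)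
open import Function.Definitions using (Injective)

≺-along-injection : {X Y K : Set} (f : X → Y) → Injective _≡_ _≡_ f →
  Y ≺ K → X ≺ K
≺-along-injection f f-inj ((g , g-inj) , K⋠Y) =
  ((λ x → g (f x)) , λ eq → f-inj (g-inj eq)) ,
  λ { (h , h-inj) → K⋠Y ((λ k → f (h k)) , λ eq → h-inj (f-inj eq)) }

Image : {X Y : Set} → (X → Y) → (X → Set) → Y → Set
Image f D y = ∃ λ x → D x × f x ≡ y

-- An image is no larger than the set it is the image of: an element of the
-- image is determined by the chosen preimage.
image-≺ : {X Y K : Set} (f : X → Y) (D : X → Set) →
  Σ X D ≺ K → Σ Y (Image f D) ≺ K
image-≺ f D = ≺-along-injection preimage preimage-inj
  where
  preimage : Σ _ (Image f D) → Σ _ D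
  preimage (_ , x , Dx , _) = x , Dx

  preimage-inj : Injective _≡_ _≡_ preimage
  preimage-inj {_ , x , Dx , refl} {_ , .x , .Dx , refl} refl = refl

restrict-≺ : {X K : Set} (D Q : X → Set) → (∀ {x} (u v : Q x) → u ≡ v) →
  Σ X D ≺ K → Σ X (λ x → D x × Q x) ≺ K
restrict-≺ D Q Q-irr = ≺-along-injection forget forget-inj
  where
  forget : Σ _ (λ x → D x × Q x) → Σ _ D
  forget (x , Dx , _) = x , Dx

  forget-inj : Injective _≡_ _≡_ forget
  forget-inj {x , Dx , u} {.x , .Dx , v} refl = cong (λ w → x , Dx , w) (Q-irr u v)

module Levels (F : Forcing) (ℓ : Forcing.Carrier F → ℕ) where
  open Forcing F
  open Gen F ℓ

  same-level⇒≤⁰ : ∀ {p q} → q ≤ p → ℓ q ≡ ℓ p → q ≤[ 0 ] p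
  same-level⇒≤⁰ {p} q≤p ℓq≡ℓp = q≤p , trans ℓq≡ℓp (sym (+-identityʳ (ℓ p)))

  -- An element of ℙ_n lying below a condition of length n has length n:
  -- if it is the top element, so is the condition above it.
  below-level : ∀ {n h f} → InLevel n h → h ≤ f → ℓ f ≡ n → ℓ h ≡ n
  below-level (inj₁ refl) 1≤f ℓf≡n rewrite antisym (one-max _) 1≤f = ℓf≡n
  below-level (inj₂ ℓh≡n) _ _ = ℓh≡n

module ForkingAtLevel
    {P A : Forcing} {ℓP : Forcing.Carrier P → ℕ} {CP : Set}
    {cP : Forcing.Carrier P → CP} {ℓA : Forcing.Carrier A → ℕ} {CA : Set}
    {cA : Forcing.Carrier A → CA}
    {fork : Forcing.Carrier A → Forcing.Carrier P → Forcing.Carrier A}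
    {π : Forcing.Carrier A → Forcing.Carrier P}
    (FP : ForkingProjection P A ℓP cP ℓA cA fork π) (n : ℕ) where

  open Forcing P using (_≤_)
  open Forcing A using (one-max) renaming (Carrier to AC; _≤_ to _⊴_; trans≤ to ⊴-trans)
  open ForkingProjection FP
  module GP = Gen P ℓP
  module GA = Gen A ℓA
  open Levels using (same-level⇒≤⁰; below-level)

  π-InLevel : ∀ {a} → GA.InLevel n a → GP.InLevel n (π a)
  π-InLevel (inj₁ refl) = inj₁ π-one
  π-InLevel {a} (inj₂ ℓa≡n) = inj₂ (trans (sym (ℓ-comm a)) ℓa≡n)

  π-directed : ∀ {D} → GA.Directed D → GP.Directed (Image π D)
  π-directed dir _ _ (d , Dd , refl) (d' , Dd' , refl) with dir d d' Dd Dd'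
  ... | z , Dz , z⊴d , z⊴d' = π z , (z , Dz , refl) , π-mono _ _ z⊴d , π-mono _ _ z⊴d'

  projected-lower-bound : ∀ {K} → GP.DirClosed n K →
    ∀ D → (∀ x → D x → GA.InLevel n x) → GA.Directed D → Σ AC D ≺ K →
    ∃ λ p → (ℓP p ≡ n) × (∀ d → D d → p ≤ π d)
  projected-lower-bound closed D inD dir small
    with closed (Image π D) (λ { _ (d , Dd , refl) → π-InLevel (inD d Dd) })
                (π-directed dir) (image-≺ π D small)
  ... | p , ℓp≡n , p≤ = p , ℓp≡n , λ d Dd → p≤ (π d) (d , Dd , refl)

  module Forked (D : AC → Set) (inD : ∀ x → D x → GA.InLevel n x)
                (dir : GA.Directed D) (p : Forcing.Carrier P)
                (ℓp≡n : ℓP p ≡ n) (p≤ : ∀ d → D d → p ≤ π d) where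

    Dₙ : AC → Set
    Dₙ d = D d × ℓA d ≡ n

    Dₚ : AC → Set
    Dₚ = Image (λ d → fork d p) Dₙ

    π-Dₚ : ∀ {x} → Dₚ x → π x ≡ p
    π-Dₚ (d , (Dd , _) , refl) = π-fork d p (p≤ d Dd)

    π-constant : ∀ x y → Dₚ x → Dₚ y → π x ≡ π y
    π-constant _ _ Dx Dy = trans (π-Dₚ Dx) (sym (π-Dₚ Dy))

    Dₚ-level : ∀ x → Dₚ x → GA.InLevel n x
    Dₚ-level x Dx = inj₂ (trans (ℓ-comm x) (trans (cong ℓP (π-Dₚ Dx)) ℓp≡n))

    Dₚ-small : ∀ {K} → Σ AC D ≺ K → Σ AC Dₚ ≺ K
    Dₚ-small small =
      image-≺ (λ d → fork d p) Dₙ (restrict-≺ D (λ d → ℓA d ≡ n) ≡-irrelevant small)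

    -- Dₚ is directed: a common extension h ∈ D of f, g ∈ Dₙ is a 0-step
    -- extension of both, so ⋔_h(p) ⊴ ⋔_f(p), ⋔_g(p) by (F7).
    Dₚ-directed : GA.Directed Dₚ
    Dₚ-directed _ _ (f , (Df , ℓf≡n) , refl) (g , (Dg , ℓg≡n) , refl)
      with dir f g Df Dg
    ... | h , Dh , h⊴f , h⊴g =
      fork h p , (h , (Dh , ℓh≡n) , refl) ,
      fork-0 f h p (same-level⇒≤⁰ A ℓA h⊴f (trans ℓh≡n (sym ℓf≡n))) p≤⁰πh ,
      fork-0 g h p (same-level⇒≤⁰ A ℓA h⊴g (trans ℓh≡n (sym ℓg≡n))) p≤⁰πh
      where
      ℓh≡n : ℓA h ≡ n
      ℓh≡n = below-level A ℓA (inD h Dh) h⊴f ℓf≡n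

      p≤⁰πh : p GP.≤[ 0 ] π h
      p≤⁰πh = same-level⇒≤⁰ P ℓP (p≤ h Dh) (trans ℓp≡n (sym (trans (sym (ℓ-comm h)) ℓh≡n)))

    -- Step 3: a lower bound of Dₚ in A_n is a lower bound of D, as
    -- ⋔_d(p) ⊴ d (F2) and every condition lies below the top element.
    bound-of-D : (∃ λ b → (ℓA b ≡ n) × (∀ x → Dₚ x → b ⊴ x)) →
                 ∃ λ b → (ℓA b ≡ n) × (∀ d → D d → b ⊴ d)
    bound-of-D (b , ℓb≡n , b⊴) = b , ℓb≡n , below-D
      where
      below-D : ∀ d → D d → b ⊴ d
      below-D d Dd with inD d Dd
      ... | inj₁ refl = one-max b
      ... | inj₂ ℓd≡n =
        ⊴-trans (b⊴ (fork d p) (d , (Dd , ℓd≡n) , refl)) (fork-cone d p (p≤ d Dd))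

lemma4p6 : (Sg : CardSeq) (μ : Set) (P A : Forcing)
    (ℓP : Forcing.Carrier P → ℕ) (CP : Set) (cP : Forcing.Carrier P → CP)
    (ℓA : Forcing.Carrier A → ℕ) (CA : Set) (cA : Forcing.Carrier A → CA)
    (fork : Forcing.Carrier A → Forcing.Carrier P → Forcing.Carrier A)
    (π : Forcing.Carrier A → Forcing.Carrier P) →
    SigmaPrikry Sg μ P ℓP CP cP →
    ForkingProjection P A ℓP cP ℓA cA fork π →
    (n : ℕ) →
    (∀ (D : Forcing.Carrier A → Set) →
      (∀ x → D x → Gen.InLevel A ℓA n x) →
      Gen.Directed A ℓA D →
      Σ (Forcing.Carrier A) D ≺ CardSeq.κs Sg n →
      (∀ d d' → D d → D d' → π d ≡ π d') →
      ∃ λ b → (ℓA b ≡ n) × (∀ x → D x → Forcing._≤_ A b x)) →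
    Gen.DirClosed A ℓA n (CardSeq.κs Sg n)
lemma4p6 Sg μ P A ℓP CP cP ℓA CA cA fork π SP FP n closed-on-fibres D inD dir small
  with ForkingAtLevel.projected-lower-bound FP n (SigmaPrikry.closed SP n) D inD dir small
... | p , ℓp≡n , p≤ =
  bound-of-D (closed-on-fibres Dₚ Dₚ-level Dₚ-directed (Dₚ-small small) π-constant)
  where open ForkingAtLevel.Forked FP n D inD dir p ℓp≡n p≤
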